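{- Let $k>2$ be an integer. For $1\le i\le k$ let $N_i=\binom{k-1}{i-1}$ and let $T^k_i=(t^k_i(p,q))_{1\le p,q\le N_i}$ be the $N_i\times N_i$ $0/1$-matrix defined as follows: let $A(1),\dots,A(N_i)$ be the compositions $(a_1,\dots,a_i)$ of $k+1$ into $i$ positive parts with $a_1\ge 2$, and $B(1),\dots,B(N_i)$ the compositions $(b_1,\dots,b_i)$ of $k$ into $i$ positive parts, each list in descending lexicographic order; set $t^k_i(p,q)=1$ if $\sum_{j=1}^{h}(a_j(p)-b_j(q))>0$ for all $h=1,\dots,i$, and $t^k_i(p,q)=0$ otherwise. For $m\ge 1$ let $\mathcal{M}_m=(m_{pq})$ be the $m\times m$ matrix with $m_{pq}=1$ if $p\le q$ and $m_{pq}=0$ otherwise. Then $T^k_1=T^k_k=[1]$ and $T^k_2=T^k_{k-1}=\mathcal{M}_{k-1}$.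
   Context: A composition of a positive integer $n$ into $i$ parts is an ordered $i$-tuple of positive integers with sum $n$; $A(p)=(a_1(p),\dots,a_i(p))$ and $B(q)=(b_1(q),\dots,b_i(q))$ denote the $p$-th and $q$-th compositions in the respective lists. -}

module Defs where

open import Data.Nat using (ℕ; zero; suc; _+_; _∸_; _≤ᵇ_; _<ᵇ_)
open import Data.Bool using (Bool; true; false; if_then_else_)
open import Data.List using (List; []; _∷_; map; concatMap; take; upTo; applyDownFrom; filterᵇ)
open import Data.List.Base using (all)
open import Data.Nat.ListAction using (sum)
open import Relation.Nullary.Decidable using (does)
open import Data.Nat.Properties using (_≟_)

downFrom1 : ℕ → List ℕ
downFrom1 n = applyDownFrom suc n

compositions : ℕ → ℕ → List (List ℕ)
compositions zero    zero    = [] ∷ []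
compositions (suc _) zero    = []
compositions n       (suc i) =
  concatMap (λ a → map (a ∷_) (compositions (n ∸ a) i)) (downFrom1 n)

firstAtLeast2 : List ℕ → Bool
firstAtLeast2 []      = false
firstAtLeast2 (a ∷ _) = 2 ≤ᵇ a

Alist : ℕ → ℕ → List (List ℕ)
Alist k i = filterᵇ firstAtLeast2 (compositions (suc k) i)

Blist : ℕ → ℕ → List (List ℕ)
Blist k i = compositions k i

-- t(p,q) = 1 iff for all h = 1..i, sum_{j≤h} (a_j - b_j) > 0,
-- i.e. sum_{j≤h} b_j < sum_{j≤h} a_j (in ℕ, no truncation involved).
entry : ℕ → List ℕ → List ℕ → ℕ
entry i a b =
  if all (λ h → sum (take h b) <ᵇ sum (take h a)) (map suc (upTo i)) then 1 else 0

T : ℕ → ℕ → List (List ℕ)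
T k i = map (λ a → map (λ b → entry i a b) (Blist k i)) (Alist k i)

M : ℕ → List (List ℕ)
M m = map (λ p → map (λ q → if p ≤ᵇ q then 1 else 0) (map suc (upTo m))) (map suc (upTo m))

-- A(p) is B(p) with its first part raised by one, so t(p,q) = 1 says that every prefix
-- sum of B(q) is at most the corresponding prefix sum of B(p): T^k_i is the dominance
-- matrix of the compositions of k into i parts.  For i = 1 and i = k there is only one
-- composition.  For i = 2 the compositions are (k-p, p) and for i = k-1 they are
-- (1,…,1,2,1,…,1) with the 2 in position p; in both cases B(q) is dominated by B(p)
-- exactly when p ≤ q.  Each matrix is then recognised as M row by row: the first row is
-- all ones, the rest of the first column is zero, and the remaining block has the same shape.
module Submission where

open import Defs
open import Data.Nat using (ℕ; _<_; _∸_)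
open import Data.List using (List; []; _∷_)
open import Data.Product using (_×_)
open import Relation.Binary.PropositionalEquality using (_≡_)

open import Data.Nat using (zero; suc; _+_; _≤_; _<ᵇ_; z≤n; s≤s)
open import Data.Nat.Properties
  using (+-assoc; +-comm; +-suc; +-identityʳ; m+n∸m≡n; ≤-refl; ≤-reflexive; ≤-trans; n≤1+n; m≤m+n;
         +-monoˡ-<)
open import Data.Bool using (Bool; true; false; if_then_else_; _∧_)
open import Data.List using (map; concatMap; take; upTo; filterᵇ; replicate; length; _++_)
open import Data.List.Properties using (map-cong; map-∘; map-++; map-applyUpTo; length-upTo; ++-identityʳ)
open import Data.List.Relation.Unary.All using (All; []; _∷_; universal)
open import Data.List.Relation.Unary.All.Properties using (map⁺)
open import Data.Nat.ListAction using (sum)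
open import Data.Bool.ListAction using (all; and)
open import Function using (id; _∘′_)
open import Data.Product using (_,_)
open import Relation.Binary.PropositionalEquality using (refl; sym; trans; cong; cong₂; subst; module ≡-Reasoning)
open ≡-Reasoning

private
  variable
    A B : Set

bit : Bool → ℕ
bit b = if b then 1 else 0

<ᵇ-true : ∀ {m n} → m < n → (m <ᵇ n) ≡ true
<ᵇ-true {zero}  (s≤s _)   = refl
<ᵇ-true {suc m} (s≤s m<n) = <ᵇ-true m<n

<ᵇ-false : ∀ {m n} → n ≤ m → (m <ᵇ n) ≡ false
<ᵇ-false {n = zero}      _         = refl
<ᵇ-false {suc m} {suc n} (s≤s n≤m) = <ᵇ-false n≤m

upTo-suc : ∀ m → upTo (suc m) ≡ 0 ∷ map suc (upTo m)
upTo-suc m = cong (0 ∷_) (sym (map-applyUpTo id suc m))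

table : (A → B → ℕ) → List A → List B → List (List ℕ)
table f as bs = map (λ a → map (f a) bs) as

table-cong : ∀ {f g : A → B → ℕ} → (∀ a b → f a b ≡ g a b) →
  ∀ as bs → table f as bs ≡ table g as bs
table-cong f≡g as bs = map-cong (λ a → map-cong (f≡g a) bs) as

table-map : ∀ {C D : Set} (f : A → B → ℕ) (g : C → A) (h : D → B) as bs →
  table f (map g as) (map h bs) ≡ table (λ a b → f (g a) (h b)) as bs
table-map f g h as bs = trans (sym (map-∘ as)) (map-cong (λ a → sym (map-∘ bs)) as)

head₀ : List ℕ → ℕ
head₀ []      = 0
head₀ (x ∷ _) = x

tail₀ : List ℕ → List ℕ
tail₀ []       = []
tail₀ (_ ∷ xs) = xs

dominates : ℕ → ℕ → ℕ → List ℕ → List ℕ → Bool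
dominates zero    sa sb a b = true
dominates (suc i) sa sb a b =
  (sb + head₀ b <ᵇ sa + head₀ a) ∧ dominates i (sa + head₀ a) (sb + head₀ b) (tail₀ a) (tail₀ b)

dominates-∷ : ∀ i sa sb {x y} a b → sb + y < sa + x →
  dominates (suc i) sa sb (x ∷ a) (y ∷ b) ≡ dominates i (sa + x) (sb + y) a b
dominates-∷ i sa sb a b lt rewrite <ᵇ-true lt = refl

dominates-∷-false : ∀ i sa sb {x y} a b → sa + x ≤ sb + y →
  dominates (suc i) sa sb (x ∷ a) (y ∷ b) ≡ false
dominates-∷-false i sa sb a b ge rewrite <ᵇ-false ge = refl

sum-take-suc : ∀ h a → sum (take (suc h) a) ≡ head₀ a + sum (take h (tail₀ a))
sum-take-suc zero    []      = refl
sum-take-suc (suc h) []      = refl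
sum-take-suc h       (x ∷ a) = refl

all-prefixes≡dominates : ∀ i sa sb a b →
  all (λ h → sb + sum (take h b) <ᵇ sa + sum (take h a)) (map suc (upTo i)) ≡ dominates i sa sb a b
all-prefixes≡dominates zero    sa sb a b = refl
all-prefixes≡dominates (suc i) sa sb a b = begin
  all P (map suc (upTo (suc i)))            ≡⟨ cong (all P ∘′ map suc) (upTo-suc i) ⟩
  P 1 ∧ and (map P (map suc (map suc U)))   ≡⟨ cong₂ _∧_ first (cong and (sym (map-∘ (map suc U)))) ⟩
  _ ∧ and (map (P ∘′ suc) (map suc U))      ≡⟨ cong (_ ∧_) (cong and (map-cong shift (map suc U))) ⟩
  _ ∧ all P′ (map suc U)                    ≡⟨ cong (_ ∧_) (all-prefixes≡dominates i _ _ _ _) ⟩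
  dominates (suc i) sa sb a b               ∎
  where
  U : List ℕ
  U = upTo i
  P P′ : ℕ → Bool
  P  h = sb + sum (take h b) <ᵇ sa + sum (take h a)
  P′ h = (sb + head₀ b) + sum (take h (tail₀ b)) <ᵇ (sa + head₀ a) + sum (take h (tail₀ a))
  sum-take-one : ∀ s c → s + sum (take 1 c) ≡ s + head₀ c
  sum-take-one s c = cong (s +_) (trans (sum-take-suc 0 c) (+-identityʳ _))
  first : P 1 ≡ (sb + head₀ b <ᵇ sa + head₀ a)
  first = cong₂ _<ᵇ_ (sum-take-one sb b) (sum-take-one sa a)
  shift-sum : ∀ s c h → s + sum (take (suc h) c) ≡ (s + head₀ c) + sum (take h (tail₀ c))
  shift-sum s c h = trans (cong (s +_) (sum-take-suc h c)) (sym (+-assoc s _ _))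
  shift : ∀ h → P (suc h) ≡ P′ h
  shift h = cong₂ _<ᵇ_ (shift-sum sb b h) (shift-sum sa a h)

-- The compositions of n + r into suc i parts whose first part is at most n,
-- in the order of `compositions`.
boundedHead : ℕ → ℕ → ℕ → List (List ℕ)
boundedHead i zero    r = []
boundedHead i (suc n) r = map (suc n ∷_) (compositions r i) ++ boundedHead i n (suc r)

concatMap≡boundedHead : ∀ i N n r → N ≡ n + r →
  concatMap (λ a → map (a ∷_) (compositions (N ∸ a) i)) (downFrom1 n) ≡ boundedHead i n r
concatMap≡boundedHead i N zero    r N≡ = refl
concatMap≡boundedHead i N (suc n) r N≡ = cong₂ _++_
  (cong (map (suc n ∷_) ∘′ (λ m → compositions m i)) (trans (cong (_∸ suc n) N≡) (m+n∸m≡n (suc n) r)))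
  (concatMap≡boundedHead i N n (suc r) (trans N≡ (sym (+-suc n r))))

compositions≡boundedHead : ∀ N i → compositions N (suc i) ≡ boundedHead i N 0
compositions≡boundedHead zero    i = refl
compositions≡boundedHead (suc N) i = concatMap≡boundedHead i (suc N) (suc N) 0 (sym (+-identityʳ _))

-- The skipped blocks are empty: their remainder is too small to be split into i parts.
boundedHead-skip : ∀ {i} → (∀ {r} → r < i → compositions r i ≡ []) →
  ∀ m n r → r + m ≤ i → boundedHead i (m + n) r ≡ boundedHead i n (m + r)
boundedHead-skip         empty zero    n r _  = refl
boundedHead-skip {i = i} empty (suc m) n r le = begin
  map (suc (m + n) ∷_) (compositions r i) ++ boundedHead i (m + n) (suc r)
    ≡⟨ cong (λ L → map (suc (m + n) ∷_) L ++ boundedHead i (m + n) (suc r)) (empty r<i) ⟩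
  boundedHead i (m + n) (suc r)  ≡⟨ boundedHead-skip empty m n (suc r) le′ ⟩
  boundedHead i n (m + suc r)    ≡⟨ cong (boundedHead i n) (+-suc m r) ⟩
  boundedHead i n (suc m + r)    ∎
  where
  le′ : suc r + m ≤ i
  le′ = subst (_≤ i) (+-suc r m) le
  r<i : r < i
  r<i = ≤-trans (s≤s (m≤m+n r m)) le′

compositions-< : ∀ {r i} → r < i → compositions r i ≡ []
compositions-< {zero}  {suc i} _         = refl
compositions-< {suc r} {suc i} (s≤s r<i) = begin
  compositions (suc r) (suc i)    ≡⟨ compositions≡boundedHead (suc r) i ⟩
  boundedHead i (suc r) 0         ≡⟨ cong (λ n → boundedHead i n 0) (sym (+-identityʳ (suc r))) ⟩
  boundedHead i (suc r + 0) 0     ≡⟨ boundedHead-skip compositions-< (suc r) 0 0 r<i ⟩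
  []                              ∎

compositions-excess : ∀ e i → compositions (suc e + i) (suc i) ≡ boundedHead i (suc e) i
compositions-excess e i = begin
  compositions (suc e + i) (suc i)  ≡⟨ cong (λ N → compositions N (suc i)) (+-comm (suc e) i) ⟩
  compositions (i + suc e) (suc i)  ≡⟨ compositions≡boundedHead (i + suc e) i ⟩
  boundedHead i (i + suc e) 0       ≡⟨ boundedHead-skip compositions-< i (suc e) 0 ≤-refl ⟩
  boundedHead i (suc e) (i + 0)     ≡⟨ cong (boundedHead i (suc e)) (+-identityʳ i) ⟩
  boundedHead i (suc e) i           ∎

ones : ℕ → List ℕ
ones n = replicate n 1

compositions-diagonal : ∀ i → compositions i i ≡ ones i ∷ []
compositions-diagonal zero    = refl
compositions-diagonal (suc i) = begin
  compositions (suc i) (suc i)        ≡⟨ compositions-excess 0 i ⟩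
  map (1 ∷_) (compositions i i) ++ [] ≡⟨ cong (λ L → map (1 ∷_) L ++ []) (compositions-diagonal i) ⟩
  ones (suc i) ∷ []                   ∎

onesWithTwo : ℕ → List (List ℕ)
onesWithTwo zero    = []
onesWithTwo (suc i) = (2 ∷ ones i) ∷ map (1 ∷_) (onesWithTwo i)

compositions-subdiagonal : ∀ i → compositions (suc i) i ≡ onesWithTwo i
compositions-subdiagonal zero    = refl
compositions-subdiagonal (suc i) = begin
  compositions (2 + i) (suc i)
    ≡⟨ compositions-excess 1 i ⟩
  map (2 ∷_) (compositions i i) ++ map (1 ∷_) (compositions (suc i) i) ++ []
    ≡⟨ cong₂ (λ L L′ → map (2 ∷_) L ++ map (1 ∷_) L′ ++ [])
             (compositions-diagonal i) (compositions-subdiagonal i) ⟩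
  (2 ∷ ones i) ∷ map (1 ∷_) (onesWithTwo i) ++ []
    ≡⟨ cong ((2 ∷ ones i) ∷_) (++-identityʳ _) ⟩
  onesWithTwo (suc i) ∎

compositions-one-part : ∀ N → compositions (suc N) 1 ≡ (suc N ∷ []) ∷ []
compositions-one-part N = trans (compositions≡boundedHead (suc N) 0) (cong ((suc N ∷ []) ∷_) (no-zero-parts N 0))
  where
  no-zero-parts : ∀ n r → boundedHead 0 n (suc r) ≡ []
  no-zero-parts zero    r = refl
  no-zero-parts (suc n) r = no-zero-parts n (suc r)

pairs : ℕ → ℕ → List (List ℕ)
pairs zero    r = []
pairs (suc n) r = (suc n ∷ suc r ∷ []) ∷ pairs n (suc r)

compositions-two-parts : ∀ n → compositions (suc n) 2 ≡ pairs n 0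
compositions-two-parts n = trans (compositions≡boundedHead (suc n) 1) (boundedHead≡pairs n 0)
  where
  boundedHead≡pairs : ∀ n r → boundedHead 1 n (suc r) ≡ pairs n r
  boundedHead≡pairs zero    r = refl
  boundedHead≡pairs (suc n) r =
    cong₂ (λ L L′ → map (suc n ∷_) L ++ L′) (compositions-one-part r) (boundedHead≡pairs n (suc r))

incrementHead : List ℕ → List ℕ
incrementHead a = suc (head₀ a) ∷ tail₀ a

filter-drop-ones : ∀ (L R : List (List ℕ)) →
  filterᵇ firstAtLeast2 (map (1 ∷_) L ++ R) ≡ filterᵇ firstAtLeast2 R
filter-drop-ones []      R = refl
filter-drop-ones (_ ∷ L) R = filter-drop-ones L R

filter-keep : ∀ a (L R : List (List ℕ)) →
  filterᵇ firstAtLeast2 (map (suc (suc a) ∷_) L ++ R) ≡ map (suc (suc a) ∷_) L ++ filterᵇ firstAtLeast2 R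
filter-keep a []      R = refl
filter-keep a (x ∷ L) R = cong ((suc (suc a) ∷ x) ∷_) (filter-keep a L R)

filter-boundedHead : ∀ i n r →
  filterᵇ firstAtLeast2 (boundedHead i (suc n) r) ≡ map incrementHead (boundedHead i n r)
filter-boundedHead i zero    r = filter-drop-ones (compositions r i) []
filter-boundedHead i (suc n) r = begin
  filterᵇ firstAtLeast2 (map (suc (suc n) ∷_) L ++ boundedHead i (suc n) (suc r))
    ≡⟨ filter-keep n L _ ⟩
  map (suc (suc n) ∷_) L ++ filterᵇ firstAtLeast2 (boundedHead i (suc n) (suc r))
    ≡⟨ cong₂ _++_ (map-∘ L) (filter-boundedHead i n (suc r)) ⟩
  map incrementHead (map (suc n ∷_) L) ++ map incrementHead (boundedHead i n (suc r))
    ≡⟨ sym (map-++ incrementHead (map (suc n ∷_) L) _) ⟩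
  map incrementHead (boundedHead i (suc n) r) ∎
  where
  L : List (List ℕ)
  L = compositions r i

Alist≡incrementHead : ∀ k i → Alist k (suc i) ≡ map incrementHead (Blist k (suc i))
Alist≡incrementHead k i = begin
  filterᵇ firstAtLeast2 (compositions (suc k) (suc i))
    ≡⟨ cong (filterᵇ firstAtLeast2) (compositions≡boundedHead (suc k) i) ⟩
  filterᵇ firstAtLeast2 (boundedHead i (suc k) 0)  ≡⟨ filter-boundedHead i k 0 ⟩
  map incrementHead (boundedHead i k 0)
    ≡⟨ cong (map incrementHead) (sym (compositions≡boundedHead k i)) ⟩
  map incrementHead (compositions k (suc i)) ∎

T≡dominance : ∀ k i {Bs} → Blist k (suc i) ≡ Bs →
  T k (suc i) ≡ table (λ a b → bit (dominates (suc i) 1 0 a b)) Bs Bs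
T≡dominance k i {Bs} Blist≡ = begin
  table (entry (suc i)) (Alist k (suc i)) Bs′
    ≡⟨ table-cong (λ a b → cong bit (all-prefixes≡dominates (suc i) 0 0 a b)) (Alist k (suc i)) Bs′ ⟩
  table (λ a b → bit (dominates (suc i) 0 0 a b)) (Alist k (suc i)) Bs′
    ≡⟨ cong (λ As → table (λ a b → bit (dominates (suc i) 0 0 a b)) As Bs′) (Alist≡incrementHead k i) ⟩
  table (λ a b → bit (dominates (suc i) 0 0 a b)) (map incrementHead Bs′) Bs′
    ≡⟨ sym (map-∘ Bs′) ⟩
  table (λ a b → bit (dominates (suc i) 1 0 a b)) Bs′ Bs′
    ≡⟨ cong (λ L → table (λ a b → bit (dominates (suc i) 1 0 a b)) L L) Blist≡ ⟩
  table (λ a b → bit (dominates (suc i) 1 0 a b)) Bs Bs ∎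
  where
  Bs′ : List (List ℕ)
  Bs′ = Blist k (suc i)

-- M m re-indexed from 0, so that the comparison computes as soon as p or q is a successor.
staircase : List ℕ → List (List ℕ)
staircase xs = map (λ p → map (λ q → bit (p <ᵇ suc q)) xs) xs

M≡staircase : ∀ m → M m ≡ staircase (upTo m)
M≡staircase m = trans (sym (map-∘ (upTo m))) (map-cong (λ p → sym (map-∘ (upTo m))) (upTo m))

map-const-one : ∀ (xs : List ℕ) → map (λ _ → 1) xs ≡ ones (length xs)
map-const-one []       = refl
map-const-one (x ∷ xs) = cong (1 ∷_) (map-const-one xs)

staircase-suc : ∀ xs → staircase (0 ∷ map suc xs) ≡ ones (suc (length xs)) ∷ map (0 ∷_) (staircase xs)
staircase-suc xs = cong₂ _∷_ first-row other-rows
  where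
  first-row : 1 ∷ map (λ _ → 1) (map suc xs) ≡ ones (suc (length xs))
  first-row = cong (1 ∷_) (trans (sym (map-∘ xs)) (map-const-one xs))
  other-rows : map (λ p → map (λ q → bit (p <ᵇ suc q)) (0 ∷ map suc xs)) (map suc xs)
             ≡ map (0 ∷_) (staircase xs)
  other-rows = begin
    map (λ p → map (λ q → bit (p <ᵇ suc q)) (0 ∷ map suc xs)) (map suc xs)
      ≡⟨ sym (map-∘ xs) ⟩
    map (λ p → 0 ∷ map (λ q → bit (suc p <ᵇ suc q)) (map suc xs)) xs
      ≡⟨ map-cong (λ p → cong (0 ∷_) (sym (map-∘ xs))) xs ⟩
    map (λ p → 0 ∷ map (λ q → bit (p <ᵇ suc q)) xs) xs
      ≡⟨ map-∘ xs ⟩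
    map (0 ∷_) (staircase xs) ∎

M-suc : ∀ m → M (suc m) ≡ ones (suc m) ∷ map (0 ∷_) (M m)
M-suc m = begin
  M (suc m)                                          ≡⟨ M≡staircase (suc m) ⟩
  staircase (upTo (suc m))                           ≡⟨ cong staircase (upTo-suc m) ⟩
  staircase (0 ∷ map suc (upTo m))                   ≡⟨ staircase-suc (upTo m) ⟩
  ones (suc (length (upTo m))) ∷ map (0 ∷_) (staircase (upTo m))
    ≡⟨ cong₂ (λ n S → ones (suc n) ∷ map (0 ∷_) S) (length-upTo m) (sym (M≡staircase m)) ⟩
  ones (suc m) ∷ map (0 ∷_) (M m) ∎

table-staircase : ∀ {m as bs} (f : A → B → ℕ) a b →
  map (f a) (b ∷ bs) ≡ ones (suc m) → All (λ a′ → f a′ b ≡ 0) as → table f as bs ≡ M m →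
  table f (a ∷ as) (b ∷ bs) ≡ M (suc m)
table-staircase {m = m} {bs = bs} f a b first-row first-column rest = begin
  table f (a ∷ _) (b ∷ bs)                         ≡⟨ cong₂ _∷_ first-row (zero-column first-column) ⟩
  ones (suc m) ∷ map (0 ∷_) (table f _ bs)         ≡⟨ cong (λ S → ones (suc m) ∷ map (0 ∷_) S) rest ⟩
  ones (suc m) ∷ map (0 ∷_) (M m)                  ≡⟨ sym (M-suc m) ⟩
  M (suc m) ∎
  where
  zero-column : ∀ {as} → All (λ a′ → f a′ b ≡ 0) as →
    map (λ a′ → map (f a′) (b ∷ bs)) as ≡ map (0 ∷_) (table f as bs)
  zero-column []                = refl
  zero-column {a′ ∷ _} (z ∷ zs) = cong₂ _∷_ (cong (_∷ map (f a′) bs) z) (zero-column zs)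

pairs-row : ∀ n r {x y} → n ≤ x → n + suc r ≡ x + y →
  map (λ b → bit (dominates 2 1 0 (x ∷ y ∷ []) b)) (pairs n r) ≡ ones n
pairs-row zero    r         _   _    = refl
pairs-row (suc n) r {x} {y} n<x sum≡ = cong₂ _∷_ first
  (pairs-row n (suc r) (≤-trans (n≤1+n n) n<x) (trans (+-suc n (suc r)) sum≡))
  where
  first : bit (dominates 2 1 0 (x ∷ y ∷ []) (suc n ∷ suc r ∷ [])) ≡ 1
  first = cong bit (trans (dominates-∷ 1 1 0 (y ∷ []) (suc r ∷ []) (s≤s n<x))
                          (dominates-∷ 0 (suc x) (suc n) [] [] (s≤s (≤-reflexive sum≡))))

pairs-column : ∀ n r {x y} → n < x → All (λ a → bit (dominates 2 1 0 a (x ∷ y ∷ [])) ≡ 0) (pairs n r)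
pairs-column zero    r _   = []
pairs-column (suc n) r {x} {y} n<x =
  cong bit (dominates-∷-false 1 1 0 (suc r ∷ []) (y ∷ []) n<x)
    ∷ pairs-column n (suc r) (≤-trans (n≤1+n _) n<x)

pairs-dominance : ∀ n r → table (λ a b → bit (dominates 2 1 0 a b)) (pairs n r) (pairs n r) ≡ M n
pairs-dominance zero    r = refl
pairs-dominance (suc n) r =
  table-staircase (λ a b → bit (dominates 2 1 0 a b)) (suc n ∷ suc r ∷ []) (suc n ∷ suc r ∷ [])
    (pairs-row (suc n) r ≤-refl refl) (pairs-column n (suc r) ≤-refl) (pairs-dominance n (suc r))

dominates-head : ∀ i sa sa′ sb {x x′} a b → sa + x ≡ sa′ + x′ →
  dominates (suc i) sa sb (x ∷ a) b ≡ dominates (suc i) sa′ sb (x′ ∷ a) b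
dominates-head i sa sa′ sb a b sum≡ rewrite sum≡ = refl

ones-dominates : ∀ j {sa sb} → sb < sa → dominates j sa sb (ones j) (ones j) ≡ true
ones-dominates zero              _  = refl
ones-dominates (suc j) {sa} {sb} lt =
  trans (dominates-∷ j sa sb (ones j) (ones j) lt′) (ones-dominates j lt′)
  where
  lt′ : sb + 1 < sa + 1
  lt′ = +-monoˡ-< 1 lt

ones-row : ∀ j {sa sb} → suc sb < sa →
  map (λ b → bit (dominates j sa sb (ones j) b)) (onesWithTwo j) ≡ ones j
ones-row zero          _  = refl
ones-row (suc j) {sa} {sb} lt = cong₂ _∷_
  (cong bit (trans (dominates-∷ j sa sb (ones j) (ones j) lt₂) (ones-dominates j lt₂)))
  (begin
    map (λ b → bit (dominates (suc j) sa sb (1 ∷ ones j) b)) (map (1 ∷_) (onesWithTwo j))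
      ≡⟨ sym (map-∘ (onesWithTwo j)) ⟩
    map (λ d → bit (dominates (suc j) sa sb (1 ∷ ones j) (1 ∷ d))) (onesWithTwo j)
      ≡⟨ map-cong (λ d → cong bit (dominates-∷ j sa sb (ones j) d lt₁)) (onesWithTwo j) ⟩
    map (λ d → bit (dominates j (sa + 1) (sb + 1) (ones j) d)) (onesWithTwo j)
      ≡⟨ ones-row j (+-monoˡ-< 1 lt) ⟩
    ones j ∎)
  where
  lt₁ : sb + 1 < sa + 1
  lt₁ = +-monoˡ-< 1 (≤-trans (n≤1+n _) lt)
  lt₂ : sb + 2 < sa + 1
  lt₂ = subst (_< sa + 1) (sym (+-suc sb 1)) (+-monoˡ-< 1 lt)

onesWithTwo-dominance : ∀ j s →
  table (λ a b → bit (dominates j (suc s) s a b)) (onesWithTwo j) (onesWithTwo j) ≡ M j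
onesWithTwo-dominance zero    s = refl
onesWithTwo-dominance (suc j) s = table-staircase f (2 ∷ ones j) (2 ∷ ones j) first-row first-column (begin
  table f (map (1 ∷_) W) (map (1 ∷_) W)
    ≡⟨ table-map f (1 ∷_) (1 ∷_) W W ⟩
  table (λ a b → f (1 ∷ a) (1 ∷ b)) W W
    ≡⟨ table-cong (λ a b → cong bit (dominates-∷ j (suc s) s a b ≤-refl)) W W ⟩
  table (λ a b → bit (dominates j (suc s + 1) (s + 1) a b)) W W
    ≡⟨ onesWithTwo-dominance j (s + 1) ⟩
  M j ∎)
  where
  W : List (List ℕ)
  W = onesWithTwo j
  f : List ℕ → List ℕ → ℕ
  f a b = bit (dominates (suc j) (suc s) s a b)
  -- The row of (2,1,…,1) from offset suc s is the row of (1,…,1) from offset 2 + s.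
  first-row : map (f (2 ∷ ones j)) (onesWithTwo (suc j)) ≡ ones (suc j)
  first-row = trans
    (map-cong (λ b → cong bit (dominates-head j (suc s) (suc (suc s)) s {2} {1} (ones j) b (cong suc (+-suc s 1))))
              (onesWithTwo (suc j)))
    (ones-row (suc j) ≤-refl)
  first-column : All (λ a → f a (2 ∷ ones j) ≡ 0) (map (1 ∷_) W)
  first-column = map⁺ (universal (λ d → cong bit (dominates-∷-false j (suc s) s d (ones j) le)) W)
    where
    le : suc s + 1 ≤ s + 2
    le = ≤-reflexive (sym (+-suc s 1))

T-first : ∀ n → T (suc n) 1 ≡ (1 ∷ []) ∷ []
T-first n = trans (T≡dominance (suc n) 0 (compositions-one-part n))
  (cong (λ t → (bit t ∷ []) ∷ []) (dominates-∷ 0 1 0 {suc n} {suc n} [] [] ≤-refl))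

T-last : ∀ n → T (suc n) (suc n) ≡ (1 ∷ []) ∷ []
T-last n = trans (T≡dominance (suc n) n (compositions-diagonal (suc n)))
  (cong (λ t → (bit t ∷ []) ∷ []) (ones-dominates (suc n) {1} {0} ≤-refl))

T-second : ∀ n → T (suc n) 2 ≡ M n
T-second n = trans (T≡dominance (suc n) 1 (compositions-two-parts n)) (pairs-dominance n 0)

T-penultimate : ∀ i → T (2 + i) (1 + i) ≡ M (1 + i)
T-penultimate i = trans (T≡dominance (2 + i) i (compositions-subdiagonal (suc i))) (onesWithTwo-dominance (suc i) 0)

mainTheorem2 : (k : ℕ) → 2 < k →
    (T k 1 ≡ (1 ∷ []) ∷ []) × (T k k ≡ (1 ∷ []) ∷ []) ×
    (T k 2 ≡ M (k ∸ 1)) × (T k (k ∸ 1) ≡ M (k ∸ 1))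
mainTheorem2 (suc (suc (suc n))) (s≤s (s≤s (s≤s z≤n))) =
  T-first (2 + n) , T-last (2 + n) , T-second (2 + n) , T-penultimate (suc n)
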